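{- Let $(P_n)_{n\in\mathbb{Z}}$ be the Padovan sequence. For every integer $m\ge 0$, $$\sum_{k=0}^{m}P_{4k}=\frac15\left(P_{4(m+1)}+4P_{4m}+P_{4(m-1)}-1\right).$$
   Context: The Padovan numbers are defined by $P_0=P_1=P_2=1$ and $P_{n+3}=P_{n+1}+P_n$ for $n\ge 0$; the sequence is extended to all integers $n$ by the recurrence read backwards, $P_n=P_{n+3}-P_{n+1}$ (so $P_{ -4}=0$). -}

module Defs where

open import Data.Nat using (ℕ; zero; suc)
open import Data.Integer using (ℤ; +_; -[1+_]; _+_; _-_)
open import Data.Product using (_×_; _,_; proj₁)

Pℕ : ℕ → ℤ
Pℕ zero = + 1
Pℕ (suc zero) = + 1
Pℕ (suc (suc zero)) = + 1
Pℕ (suc (suc (suc n))) = Pℕ (suc n) + Pℕ n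

-- Backwards: triple (P_{-n}, P_{-n+1}, P_{-n+2}), using P_j = P_{j+3} - P_{j+1}
Pback : ℕ → ℤ × ℤ × ℤ
Pback zero = (+ 1 , + 1 , + 1)
Pback (suc n) = step (Pback n)
  where
  step : ℤ × ℤ × ℤ → ℤ × ℤ × ℤ
  step (a , b , c) = (c - a , a , b)

P : ℤ → ℤ
P (+ n) = Pℕ n
P -[1+ n ] = proj₁ (Pback (suc n))

sumTo : ℕ → (ℕ → ℤ) → ℤ
sumTo zero f = f zero
sumTo (suc m) f = sumTo m f + f (suc m)

-- Along every fourth term the Padovan sequence satisfies the recurrence
-- P(n+12) = 2 P(n+8) + 3 P(n+4) + P(n), because x³ - x - 1 divides
-- x¹² - 2x⁸ - 3x⁴ - 1.  With it, the right-hand side R(m) of the identity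
-- grows by exactly 5 P(4(m+1)) from m to m+1, so 5 Σ P(4k) telescopes to R(m);
-- at m = 0 and m = 1 everything is concrete, using P(-4) = 0.
module Submission where

open import Defs
open import Data.Nat using (ℕ; suc; zero)
import Data.Nat as ℕ
import Data.Nat.Properties as ℕ
open import Data.Integer using (ℤ; +_; _+_; _-_; _*_)
open import Data.Integer.Properties using (pos-*; *-distribˡ-+)
open import Data.Integer.Tactic.RingSolver using (solve-∀)
open import Relation.Binary.PropositionalEquality

sumTo-telescope : (c : ℤ) (f g : ℕ → ℤ) →
                  c * f 0 ≡ g 0 → (∀ k → g (suc k) ≡ g k + c * f (suc k)) →
                  ∀ m → c * sumTo m f ≡ g m
sumTo-telescope c f g base step zero = base
sumTo-telescope c f g base step (suc m) = begin
  c * (sumTo m f + f (suc m))     ≡⟨ *-distribˡ-+ c (sumTo m f) (f (suc m)) ⟩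
  c * sumTo m f + c * f (suc m)   ≡⟨ cong (_+ c * f (suc m)) (sumTo-telescope c f g base step m) ⟩
  g m + c * f (suc m)             ≡⟨ step m ⟨
  g (suc m)                       ∎
  where open ≡-Reasoning

-- Pℕ (k + n) unfolds definitionally to the term pₖ built from
-- p₀ = Pℕ n, p₁, p₂ by the recurrence, so the identity is one of polynomials.
Pℕ-+12 : ∀ n → Pℕ (12 ℕ.+ n) ≡ + 2 * Pℕ (8 ℕ.+ n) + + 3 * Pℕ (4 ℕ.+ n) + Pℕ n
Pℕ-+12 n = unrolled (Pℕ n) (Pℕ (1 ℕ.+ n)) (Pℕ (2 ℕ.+ n))
  where
  unrolled : ∀ p₀ p₁ p₂ →
    let p₃ = p₁ + p₀ ; p₄ = p₂ + p₁ ; p₅ = p₃ + p₂ ; p₆ = p₄ + p₃ ; p₇ = p₅ + p₄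
        p₈ = p₆ + p₅ ; p₉ = p₇ + p₆ ; p₁₀ = p₈ + p₇ ; p₁₂ = p₁₀ + p₉
    in p₁₂ ≡ + 2 * p₈ + + 3 * p₄ + p₀
  unrolled = solve-∀

P-4* : ∀ n → P (+ 4 * + n) ≡ Pℕ (4 ℕ.* n)
P-4* n = cong P (sym (pos-* 4 n))

Pℕ-4*-recurrence : ∀ k → Pℕ (4 ℕ.* (3 ℕ.+ k))
                       ≡ + 2 * Pℕ (4 ℕ.* (2 ℕ.+ k)) + + 3 * Pℕ (4 ℕ.* (1 ℕ.+ k)) + Pℕ (4 ℕ.* k)
Pℕ-4*-recurrence k = begin
  Pℕ (4 ℕ.* (3 ℕ.+ k))
    ≡⟨ cong Pℕ (ℕ.*-distribˡ-+ 4 3 k) ⟩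
  Pℕ (12 ℕ.+ 4 ℕ.* k)
    ≡⟨ Pℕ-+12 (4 ℕ.* k) ⟩
  + 2 * Pℕ (8 ℕ.+ 4 ℕ.* k) + + 3 * Pℕ (4 ℕ.+ 4 ℕ.* k) + Pℕ (4 ℕ.* k)
    ≡⟨ cong₂ (λ i j → + 2 * Pℕ i + + 3 * Pℕ j + Pℕ (4 ℕ.* k))
             (ℕ.*-distribˡ-+ 4 2 k) (ℕ.*-distribˡ-+ 4 1 k) ⟨
  + 2 * Pℕ (4 ℕ.* (2 ℕ.+ k)) + + 3 * Pℕ (4 ℕ.* (1 ℕ.+ k)) + Pℕ (4 ℕ.* k)
    ∎
  where open ≡-Reasoning

rhs : ℕ → ℤ
rhs m = P (+ 4 * (+ m + + 1)) + + 4 * P (+ 4 * + m) + P (+ 4 * (+ m - + 1)) - + 1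

rhs-suc : ∀ k → rhs (suc k)
              ≡ Pℕ (4 ℕ.* (2 ℕ.+ k)) + + 4 * Pℕ (4 ℕ.* (1 ℕ.+ k)) + Pℕ (4 ℕ.* k) - + 1
rhs-suc k = begin
  rhs (suc k)
    ≡⟨ cong (λ i → P (+ 4 * + i) + + 4 * P (+ 4 * + suc k) + P (+ 4 * + k) - + 1)
            (ℕ.+-comm (suc k) 1) ⟩
  P (+ 4 * + (2 ℕ.+ k)) + + 4 * P (+ 4 * + suc k) + P (+ 4 * + k) - + 1
    ≡⟨ cong₂ (λ x y → x + + 4 * y + P (+ 4 * + k) - + 1) (P-4* (2 ℕ.+ k)) (P-4* (1 ℕ.+ k)) ⟩
  Pℕ (4 ℕ.* (2 ℕ.+ k)) + + 4 * Pℕ (4 ℕ.* (1 ℕ.+ k)) + P (+ 4 * + k) - + 1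
    ≡⟨ cong (λ z → Pℕ (4 ℕ.* (2 ℕ.+ k)) + + 4 * Pℕ (4 ℕ.* (1 ℕ.+ k)) + z - + 1) (P-4* k) ⟩
  Pℕ (4 ℕ.* (2 ℕ.+ k)) + + 4 * Pℕ (4 ℕ.* (1 ℕ.+ k)) + Pℕ (4 ℕ.* k) - + 1
    ∎
  where open ≡-Reasoning

rhs-step : ∀ k → rhs (suc k) ≡ rhs k + + 5 * P (+ 4 * + suc k)
rhs-step zero = refl
rhs-step (suc j) = begin
  rhs (2 ℕ.+ j)
    ≡⟨ rhs-suc (suc j) ⟩
  x₃ + + 4 * x₂ + x₁ - + 1
    ≡⟨ cong (λ x → x + + 4 * x₂ + x₁ - + 1) (Pℕ-4*-recurrence j) ⟩
  (+ 2 * x₂ + + 3 * x₁ + x₀) + + 4 * x₂ + x₁ - + 1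
    ≡⟨ regroup x₀ x₁ x₂ ⟩
  (x₂ + + 4 * x₁ + x₀ - + 1) + + 5 * x₂
    ≡⟨ cong₂ (λ r x → r + + 5 * x) (rhs-suc j) (P-4* (2 ℕ.+ j)) ⟨
  rhs (1 ℕ.+ j) + + 5 * P (+ 4 * + (2 ℕ.+ j))
    ∎
  where
  open ≡-Reasoning
  x₀ x₁ x₂ x₃ : ℤ
  x₀ = Pℕ (4 ℕ.* j)
  x₁ = Pℕ (4 ℕ.* (1 ℕ.+ j))
  x₂ = Pℕ (4 ℕ.* (2 ℕ.+ j))
  x₃ = Pℕ (4 ℕ.* (3 ℕ.+ j))
  regroup : ∀ a b c → (+ 2 * c + + 3 * b + a) + + 4 * c + b - + 1
                    ≡ (c + + 4 * b + a - + 1) + + 5 * c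
  regroup = solve-∀

mainTheorem8 : (m : ℕ) →
    + 5 * sumTo m (λ k → P (+ 4 * + k))
      ≡ P (+ 4 * (+ m + + 1)) + + 4 * P (+ 4 * + m) + P (+ 4 * (+ m - + 1)) - + 1
mainTheorem8 = sumTo-telescope (+ 5) (λ k → P (+ 4 * + k)) rhs refl rhs-step
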